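{- For any unrestricted $\lambda_\epsilon$-terms $s,t,e$ and any variable $x$ which does not occur free in $e$, $$s[t+\epsilon e/x]\ \sim_\epsilon\ s[t/x]+\epsilon\left(\left(\frac{\partial s}{\partial x}(e)\right)[t/x]\right).$$
   Context: Unrestricted terms of the $\lambda_\epsilon$-calculus are generated by the grammar $t ::= x \mid \lambda x.t \mid (s\ t) \mid \mathsf{D}(s)\cdot t \mid \epsilon t \mid s+t \mid 0$, over a countably infinite set of variables; $\lambda$ is the only binder, terms are considered up to $\alpha$-equivalence, and bound variables are chosen distinct from free ones. Capture-avoiding substitution $t[s/x]$ is the usual one (it replaces free occurrences of $x$ by $s$ and commutes with all constructors, renaming bound variables as needed). Differential substitution $\frac{\partial t}{\partial x}(s)$, defined when $x$ is not free in $s$, is given by induction on $t$: $\frac{\partial x}{\partial x}(s)=s$; $\frac{\partial y}{\partial x}(s)=0$ for $y\neq x$; $\frac{\partial(\lambda y.t)}{\partial x}(s)=\lambda y.\frac{\partial t}{\partial x}(s)$ (with $y\ne x$ not free in $s$); $\frac{\partial(t\ e)}{\partial x}(s)=\big((\mathsf{D}(t)\cdot\frac{\partial e}{\partial x}(s))\ e\big)+\big(\frac{\partial t}{\partial x}(s)\ (e[x+\epsilon s/x])\big)$; $\frac{\partial(\mathsf{D}(t)\cdot e)}{\partial x}(s)=\mathsf{D}(t)\cdot\frac{\partial e}{\partial x}(s)+\mathsf{D}(\frac{\partial t}{\partial x}(s))\cdot(e[x+\epsilon s/x])+\epsilon\big(\mathsf{D}(\mathsf{D}(t)\cdot e)\cdot\frac{\partial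 e}{\partial x}(s)\big)$; $\frac{\partial(\epsilon t)}{\partial x}(s)=\epsilon\frac{\partial t}{\partial x}(s)$; $\frac{\partial(t+e)}{\partial x}(s)=\frac{\partial t}{\partial x}(s)+\frac{\partial e}{\partial x}(s)$; $\frac{\partial 0}{\partial x}(s)=0$. A binary relation $\sim$ on terms is contextual if $t\sim t'$ implies $\lambda x.t\sim\lambda x.t'$ and $\epsilon t\sim\epsilon t'$, and $s\sim s'$, $t\sim t'$ imply $(s\ t)\sim(s'\ t')$, $\mathsf{D}(s)\cdot t\sim\mathsf{D}(s')\cdot t'$ and $s+t\sim s'+t'$. We write $\epsilon^k t$ for $k$-fold application of $\epsilon$. Differential equivalence $\sim_\epsilon$ is the least contextual equivalence relation containing the following pairs (for all terms $s,t,e$ and variables $x$): $(s+t)+e\sim s+(t+e)$; $s+0\sim s$; $s+t\sim t+s$; $\epsilon 0\sim 0$; $\epsilon(s+t)\sim\epsilon s+\epsilon t$; $\lambda x.0\sim 0$; $\lambda x.(s+t)\sim(\lambda x.s)+(\lambda x.t)$; $\lambda x.\epsilon t\sim\epsilon(\lambda x.t)$; $(0\ s)\sim 0$; $((s+t)\ e)\sim(s\ e)+(t\ e)$; $((\epsilon s)\ t)\sim\epsilon(s\ t)$; $\mathsf{D}(0)\cdot e\sim 0$; $\mathsf{D}(s+t)\cdot e\sim(\mathsf{D}(s)\cdot e)+(\mathsf{D}(t)\cdot e)$; $\mathsf{D}(\epsilon t)\cdot e\sim\epsilon(\mathsf{D}(t)\cdot e)$; $\mathsf{D}(s)\cdot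 0\sim 0$; $\mathsf{D}(s)\cdot(t+e)\sim\mathsf{D}(s)\cdot t+\mathsf{D}(s)\cdot e+\epsilon(\mathsf{D}(\mathsf{D}(s)\cdot t)\cdot e)$; $\mathsf{D}(s)\cdot(\epsilon t)\sim\epsilon(\mathsf{D}(s)\cdot t)$; $\mathsf{D}(\mathsf{D}(s)\cdot t)\cdot e\sim\mathsf{D}(\mathsf{D}(s)\cdot e)\cdot t$; $\epsilon^2(\mathsf{D}(\mathsf{D}(s)\cdot t)\cdot e)\sim\epsilon(\mathsf{D}(\mathsf{D}(s)\cdot t)\cdot e)$; $(s\ (t+\epsilon e))\sim(s\ t)+\epsilon((\mathsf{D}(s)\cdot e)\ t)$. -}

module Defs where

-- Unrestricted λε-terms, represented with de Bruijn indices (so α-equivalence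
-- is syntactic identity).  Variables are natural numbers; free variable x
-- at the top level is  var x , and is  var (suc x)  under one binder.

open import Data.Nat using (ℕ; zero; suc)
open import Data.Bool using (if_then_else_)
open import Data.Nat using (_≡ᵇ_)

infixl 6 _⊕_
infix 4 _∼ε_

data Tm : Set where
  var  : ℕ → Tm
  lam  : Tm → Tm
  app  : Tm → Tm → Tm
  D_·_ : Tm → Tm → Tm
  ε    : Tm → Tm
  _⊕_  : Tm → Tm → Tm
  𝟘    : Tm

ext : (ℕ → ℕ) → ℕ → ℕ
ext ρ zero    = zero
ext ρ (suc n) = suc (ρ n)

rename : (ℕ → ℕ) → Tm → Tm
rename ρ (var n)   = var (ρ n)
rename ρ (lam t)   = lam (rename (ext ρ) t)
rename ρ (app s t) = app (rename ρ s) (rename ρ t)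
rename ρ (D s · t) = D (rename ρ s) · (rename ρ t)
rename ρ (ε t)     = ε (rename ρ t)
rename ρ (s ⊕ t)   = rename ρ s ⊕ rename ρ t
rename ρ 𝟘         = 𝟘

exts : (ℕ → Tm) → ℕ → Tm
exts σ zero    = var zero
exts σ (suc n) = rename suc (σ n)

subst : (ℕ → Tm) → Tm → Tm
subst σ (var n)   = σ n
subst σ (lam t)   = lam (subst (exts σ) t)
subst σ (app s t) = app (subst σ s) (subst σ t)
subst σ (D s · t) = D (subst σ s) · (subst σ t)
subst σ (ε t)     = ε (subst σ t)
subst σ (s ⊕ t)   = subst σ s ⊕ subst σ t
subst σ 𝟘         = 𝟘

single : ℕ → Tm → ℕ → Tm
single x s n = if n ≡ᵇ x then s else var n

_[_/_] : Tm → Tm → ℕ → Tm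
t [ s / x ] = subst (single x s) t

data _∈FV_ : ℕ → Tm → Set where
  fv-var  : ∀ {x} → x ∈FV var x
  fv-lam  : ∀ {x t} → suc x ∈FV t → x ∈FV lam t
  fv-appˡ : ∀ {x s t} → x ∈FV s → x ∈FV app s t
  fv-appʳ : ∀ {x s t} → x ∈FV t → x ∈FV app s t
  fv-Dˡ   : ∀ {x s t} → x ∈FV s → x ∈FV (D s · t)
  fv-Dʳ   : ∀ {x s t} → x ∈FV t → x ∈FV (D s · t)
  fv-ε    : ∀ {x t} → x ∈FV t → x ∈FV ε t
  fv-⊕ˡ   : ∀ {x s t} → x ∈FV s → x ∈FV (s ⊕ t)
  fv-⊕ʳ   : ∀ {x s t} → x ∈FV t → x ∈FV (s ⊕ t)

-- differential substitution  ∂t/∂x(s)  written  ∂ t x s .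
-- (Total function; it is only meaningful/used when x is not free in s.)
∂ : Tm → ℕ → Tm → Tm
∂ (var y)   x s = if y ≡ᵇ x then s else 𝟘
∂ (lam t)   x s = lam (∂ t (suc x) (rename suc s))
∂ (app t e) x s =
  app (D t · ∂ e x s) e ⊕ app (∂ t x s) (e [ var x ⊕ ε s / x ])
∂ (D t · e) x s =
  D t · ∂ e x s ⊕ D (∂ t x s) · (e [ var x ⊕ ε s / x ])
    ⊕ ε (D (D t · e) · ∂ e x s)
∂ (ε t)     x s = ε (∂ t x s)
∂ (t ⊕ e)   x s = ∂ t x s ⊕ ∂ e x s
∂ 𝟘         x s = 𝟘

data _∼ε_ : Tm → Tm → Set where
  ∼refl  : ∀ {s} → s ∼ε s
  ∼sym   : ∀ {s t} → s ∼ε t → t ∼ε s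
  ∼trans : ∀ {s t e} → s ∼ε t → t ∼ε e → s ∼ε e
  c-lam : ∀ {t t'} → t ∼ε t' → lam t ∼ε lam t'
  c-ε   : ∀ {t t'} → t ∼ε t' → ε t ∼ε ε t'
  c-app : ∀ {s s' t t'} → s ∼ε s' → t ∼ε t' → app s t ∼ε app s' t'
  c-D   : ∀ {s s' t t'} → s ∼ε s' → t ∼ε t' → D s · t ∼ε D s' · t'
  c-⊕   : ∀ {s s' t t'} → s ∼ε s' → t ∼ε t' → s ⊕ t ∼ε s' ⊕ t'
  ax-assoc   : ∀ {s t e} → (s ⊕ t) ⊕ e ∼ε s ⊕ (t ⊕ e)
  ax-unit    : ∀ {s} → s ⊕ 𝟘 ∼ε s
  ax-comm    : ∀ {s t} → s ⊕ t ∼ε t ⊕ s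
  ax-ε0      : ε 𝟘 ∼ε 𝟘
  ax-ε+      : ∀ {s t} → ε (s ⊕ t) ∼ε ε s ⊕ ε t
  ax-λ0      : lam 𝟘 ∼ε 𝟘
  ax-λ+      : ∀ {s t} → lam (s ⊕ t) ∼ε lam s ⊕ lam t
  ax-λε      : ∀ {t} → lam (ε t) ∼ε ε (lam t)
  ax-app0    : ∀ {s} → app 𝟘 s ∼ε 𝟘
  ax-app+    : ∀ {s t e} → app (s ⊕ t) e ∼ε app s e ⊕ app t e
  ax-appε    : ∀ {s t} → app (ε s) t ∼ε ε (app s t)
  ax-D0ˡ     : ∀ {e} → D 𝟘 · e ∼ε 𝟘
  ax-D+ˡ     : ∀ {s t e} → D (s ⊕ t) · e ∼ε D s · e ⊕ D t · e
  ax-Dεˡ     : ∀ {t e} → D (ε t) · e ∼ε ε (D t · e)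
  ax-D0ʳ     : ∀ {s} → D s · 𝟘 ∼ε 𝟘
  ax-D+ʳ     : ∀ {s t e} →
               D s · (t ⊕ e) ∼ε D s · t ⊕ D s · e ⊕ ε (D (D s · t) · e)
  ax-Dεʳ     : ∀ {s t} → D s · (ε t) ∼ε ε (D s · t)
  ax-DD      : ∀ {s t e} → D (D s · t) · e ∼ε D (D s · e) · t
  ax-ε²DD    : ∀ {s t e} → ε (ε (D (D s · t) · e)) ∼ε ε (D (D s · t) · e)
  ax-taylor  : ∀ {s t e} → app s (t ⊕ ε e) ∼ε app s t ⊕ ε (app (D s · e) t)

-- Substitution commutes with every constructor, so each
-- case reduces to the induction hypotheses plus the linearity axioms of ∼ε
-- (sums and ε pass through λ, the function position of an application and
-- the first argument of D); in the argument positions of an application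
-- and of D the axioms ax-taylor and ax-D+ʳ expand the perturbed argument,
-- producing exactly the terms of ∂ s x e.  Freshness of x in e is what
-- makes (u [ var x ⊕ ε e / x ]) [ t / x ] equal to u [ t ⊕ ε e / x ].
module Submission where

open import Defs
open import Data.Nat using (ℕ)
open import Relation.Nullary using (¬_)
open import Algebra.Bundles using (CommutativeSemigroup)
open import Algebra.Structures using (IsCommutativeSemigroup)
open import Level using (0ℓ)
open import Data.Bool using (true; false)
open import Data.Bool.Properties using (T-≡)
open import Data.Nat using (zero; suc; _≡ᵇ_)
open import Data.Nat.Properties using (≡ᵇ⇒≡; ≡⇒≡ᵇ; suc-injective; _≟_)
open import Data.Product using (∃; _×_; _,_)
open import Function.Base using (_∘_)
open import Function.Bundles using (Equivalence)
open import Function.Definitions using (Injective)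
open import Relation.Binary.Structures using (IsEquivalence)
open import Relation.Nullary using (contradiction; yes; no)
open import Relation.Binary.PropositionalEquality
  using (_≡_; _≗_; refl; sym; trans; cong; cong₂; module ≡-Reasoning)
  renaming (subst to transport)

ext-cong : ∀ {ρ ρ′} → ρ ≗ ρ′ → ext ρ ≗ ext ρ′
ext-cong ρ≗ρ′ zero    = refl
ext-cong ρ≗ρ′ (suc n) = cong suc (ρ≗ρ′ n)

rename-cong : ∀ {ρ ρ′} → ρ ≗ ρ′ → ∀ t → rename ρ t ≡ rename ρ′ t
rename-cong ρ≗ρ′ (var n)   = cong var (ρ≗ρ′ n)
rename-cong ρ≗ρ′ (lam t)   = cong lam (rename-cong (ext-cong ρ≗ρ′) t)
rename-cong ρ≗ρ′ (app s t) = cong₂ app (rename-cong ρ≗ρ′ s) (rename-cong ρ≗ρ′ t)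
rename-cong ρ≗ρ′ (D s · t) = cong₂ D_·_ (rename-cong ρ≗ρ′ s) (rename-cong ρ≗ρ′ t)
rename-cong ρ≗ρ′ (ε t)     = cong ε (rename-cong ρ≗ρ′ t)
rename-cong ρ≗ρ′ (s ⊕ t)   = cong₂ _⊕_ (rename-cong ρ≗ρ′ s) (rename-cong ρ≗ρ′ t)
rename-cong ρ≗ρ′ 𝟘         = refl

exts-cong : ∀ {σ σ′} → σ ≗ σ′ → exts σ ≗ exts σ′
exts-cong σ≗σ′ zero    = refl
exts-cong σ≗σ′ (suc n) = cong (rename suc) (σ≗σ′ n)

subst-cong : ∀ {σ σ′} → σ ≗ σ′ → ∀ t → subst σ t ≡ subst σ′ t
subst-cong σ≗σ′ (var n)   = σ≗σ′ n
subst-cong σ≗σ′ (lam t)   = cong lam (subst-cong (exts-cong σ≗σ′) t)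
subst-cong σ≗σ′ (app s t) = cong₂ app (subst-cong σ≗σ′ s) (subst-cong σ≗σ′ t)
subst-cong σ≗σ′ (D s · t) = cong₂ D_·_ (subst-cong σ≗σ′ s) (subst-cong σ≗σ′ t)
subst-cong σ≗σ′ (ε t)     = cong ε (subst-cong σ≗σ′ t)
subst-cong σ≗σ′ (s ⊕ t)   = cong₂ _⊕_ (subst-cong σ≗σ′ s) (subst-cong σ≗σ′ t)
subst-cong σ≗σ′ 𝟘         = refl

rename-rename : ∀ ρ ρ′ t → rename ρ (rename ρ′ t) ≡ rename (λ n → ρ (ρ′ n)) t
rename-rename ρ ρ′ (var n)   = refl
rename-rename ρ ρ′ (lam t)   =
  cong lam (trans (rename-rename (ext ρ) (ext ρ′) t)
                  (rename-cong (λ { zero → refl ; (suc n) → refl }) t))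
rename-rename ρ ρ′ (app s t) = cong₂ app (rename-rename ρ ρ′ s) (rename-rename ρ ρ′ t)
rename-rename ρ ρ′ (D s · t) = cong₂ D_·_ (rename-rename ρ ρ′ s) (rename-rename ρ ρ′ t)
rename-rename ρ ρ′ (ε t)     = cong ε (rename-rename ρ ρ′ t)
rename-rename ρ ρ′ (s ⊕ t)   = cong₂ _⊕_ (rename-rename ρ ρ′ s) (rename-rename ρ ρ′ t)
rename-rename ρ ρ′ 𝟘         = refl

subst-rename : ∀ σ ρ t → subst σ (rename ρ t) ≡ subst (λ n → σ (ρ n)) t
subst-rename σ ρ (var n)   = refl
subst-rename σ ρ (lam t)   =
  cong lam (trans (subst-rename (exts σ) (ext ρ) t)
                  (subst-cong (λ { zero → refl ; (suc n) → refl }) t))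
subst-rename σ ρ (app s t) = cong₂ app (subst-rename σ ρ s) (subst-rename σ ρ t)
subst-rename σ ρ (D s · t) = cong₂ D_·_ (subst-rename σ ρ s) (subst-rename σ ρ t)
subst-rename σ ρ (ε t)     = cong ε (subst-rename σ ρ t)
subst-rename σ ρ (s ⊕ t)   = cong₂ _⊕_ (subst-rename σ ρ s) (subst-rename σ ρ t)
subst-rename σ ρ 𝟘         = refl

rename-subst : ∀ ρ σ t → rename ρ (subst σ t) ≡ subst (λ n → rename ρ (σ n)) t
rename-subst ρ σ (var n)   = refl
rename-subst ρ σ (lam t)   =
  cong lam (trans (rename-subst (ext ρ) (exts σ) t) (subst-cong exts-commute t))
  where
  exts-commute : (λ n → rename (ext ρ) (exts σ n)) ≗ exts (λ n → rename ρ (σ n))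
  exts-commute zero    = refl
  exts-commute (suc n) = trans (rename-rename (ext ρ) suc (σ n))
                               (sym (rename-rename suc ρ (σ n)))
rename-subst ρ σ (app s t) = cong₂ app (rename-subst ρ σ s) (rename-subst ρ σ t)
rename-subst ρ σ (D s · t) = cong₂ D_·_ (rename-subst ρ σ s) (rename-subst ρ σ t)
rename-subst ρ σ (ε t)     = cong ε (rename-subst ρ σ t)
rename-subst ρ σ (s ⊕ t)   = cong₂ _⊕_ (rename-subst ρ σ s) (rename-subst ρ σ t)
rename-subst ρ σ 𝟘         = refl

subst-subst : ∀ τ σ t → subst τ (subst σ t) ≡ subst (λ n → subst τ (σ n)) t
subst-subst τ σ (var n)   = refl
subst-subst τ σ (lam t)   =
  cong lam (trans (subst-subst (exts τ) (exts σ) t) (subst-cong exts-commute t))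
  where
  exts-commute : (λ n → subst (exts τ) (exts σ n)) ≗ exts (λ n → subst τ (σ n))
  exts-commute zero    = refl
  exts-commute (suc n) = trans (subst-rename (exts τ) suc (σ n))
                               (sym (rename-subst suc τ (σ n)))
subst-subst τ σ (app s t) = cong₂ app (subst-subst τ σ s) (subst-subst τ σ t)
subst-subst τ σ (D s · t) = cong₂ D_·_ (subst-subst τ σ s) (subst-subst τ σ t)
subst-subst τ σ (ε t)     = cong ε (subst-subst τ σ t)
subst-subst τ σ (s ⊕ t)   = cong₂ _⊕_ (subst-subst τ σ s) (subst-subst τ σ t)
subst-subst τ σ 𝟘         = refl

subst-id-on-FV : ∀ σ t → (∀ n → n ∈FV t → σ n ≡ var n) → subst σ t ≡ t
subst-id-on-FV σ (var n)   σ≗var = σ≗var n fv-var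
subst-id-on-FV σ (lam t)   σ≗var = cong lam (subst-id-on-FV (exts σ) t exts≗var)
  where
  exts≗var : ∀ n → n ∈FV t → exts σ n ≡ var n
  exts≗var zero    _ = refl
  exts≗var (suc n) n∈t = cong (rename suc) (σ≗var n (fv-lam n∈t))
subst-id-on-FV σ (app s t) σ≗var =
  cong₂ app (subst-id-on-FV σ s (λ n → σ≗var n ∘ fv-appˡ))
            (subst-id-on-FV σ t (λ n → σ≗var n ∘ fv-appʳ))
subst-id-on-FV σ (D s · t) σ≗var =
  cong₂ D_·_ (subst-id-on-FV σ s (λ n → σ≗var n ∘ fv-Dˡ))
             (subst-id-on-FV σ t (λ n → σ≗var n ∘ fv-Dʳ))
subst-id-on-FV σ (ε t)     σ≗var = cong ε (subst-id-on-FV σ t (λ n → σ≗var n ∘ fv-ε))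
subst-id-on-FV σ (s ⊕ t)   σ≗var =
  cong₂ _⊕_ (subst-id-on-FV σ s (λ n → σ≗var n ∘ fv-⊕ˡ))
            (subst-id-on-FV σ t (λ n → σ≗var n ∘ fv-⊕ʳ))
subst-id-on-FV σ 𝟘         σ≗var = refl

∈FV-rename⁻ : ∀ ρ {n} t → n ∈FV rename ρ t → ∃ λ m → m ∈FV t × ρ m ≡ n
∈FV-rename⁻ ρ (var m)   fv-var = m , fv-var , refl
∈FV-rename⁻ ρ (lam t)   (fv-lam n∈t) with ∈FV-rename⁻ (ext ρ) t n∈t
... | suc m , m∈t , ρm≡n = m , fv-lam m∈t , suc-injective ρm≡n
∈FV-rename⁻ ρ (app s t) (fv-appˡ n∈s) with ∈FV-rename⁻ ρ s n∈s
... | m , m∈s , ρm≡n = m , fv-appˡ m∈s , ρm≡n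
∈FV-rename⁻ ρ (app s t) (fv-appʳ n∈t) with ∈FV-rename⁻ ρ t n∈t
... | m , m∈t , ρm≡n = m , fv-appʳ m∈t , ρm≡n
∈FV-rename⁻ ρ (D s · t) (fv-Dˡ n∈s) with ∈FV-rename⁻ ρ s n∈s
... | m , m∈s , ρm≡n = m , fv-Dˡ m∈s , ρm≡n
∈FV-rename⁻ ρ (D s · t) (fv-Dʳ n∈t) with ∈FV-rename⁻ ρ t n∈t
... | m , m∈t , ρm≡n = m , fv-Dʳ m∈t , ρm≡n
∈FV-rename⁻ ρ (ε t)     (fv-ε n∈t) with ∈FV-rename⁻ ρ t n∈t
... | m , m∈t , ρm≡n = m , fv-ε m∈t , ρm≡n
∈FV-rename⁻ ρ (s ⊕ t)   (fv-⊕ˡ n∈s) with ∈FV-rename⁻ ρ s n∈s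
... | m , m∈s , ρm≡n = m , fv-⊕ˡ m∈s , ρm≡n
∈FV-rename⁻ ρ (s ⊕ t)   (fv-⊕ʳ n∈t) with ∈FV-rename⁻ ρ t n∈t
... | m , m∈t , ρm≡n = m , fv-⊕ʳ m∈t , ρm≡n

∉FV-rename : ∀ {ρ} → Injective _≡_ _≡_ ρ → ∀ {x} t → ¬ (x ∈FV t) → ¬ (ρ x ∈FV rename ρ t)
∉FV-rename ρ-inj t x∉t ρx∈t with ∈FV-rename⁻ _ t ρx∈t
... | m , m∈t , ρm≡ρx = x∉t (transport (_∈FV t) (ρ-inj ρm≡ρx) m∈t)

single-≡ : ∀ x u → single x u x ≡ u
single-≡ x u rewrite Equivalence.to T-≡ (≡⇒≡ᵇ x x refl) = refl

single-≢ : ∀ {x n} u → ¬ (n ≡ x) → single x u n ≡ var n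
single-≢ {x} {n} u n≢x with n ≡ᵇ x in eq
... | true  = contradiction (≡ᵇ⇒≡ n x (Equivalence.from T-≡ eq)) n≢x
... | false = refl

exts-single : ∀ x u → exts (single x u) ≗ single (suc x) (rename suc u)
exts-single x u zero    = refl
exts-single x u (suc n) with n ≡ᵇ x
... | true  = refl
... | false = refl

subst-fresh : ∀ {x} e t → ¬ (x ∈FV e) → e [ t / x ] ≡ e
subst-fresh e t x∉e = subst-id-on-FV _ e (λ n n∈e → single-≢ t λ { refl → x∉e n∈e })

subst-perturbed-fusion : ∀ {x} t e → ¬ (x ∈FV e) → ∀ u →
  (u [ var x ⊕ ε e / x ]) [ t / x ] ≡ u [ t ⊕ ε e / x ]
subst-perturbed-fusion {x} t e x∉e u =
  trans (subst-subst (single x t) (single x (var x ⊕ ε e)) u) (subst-cong pointwise u)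
  where
  open ≡-Reasoning
  pointwise : (λ n → single x (var x ⊕ ε e) n [ t / x ]) ≗ single x (t ⊕ ε e)
  pointwise n with n ≟ x
  ... | yes refl = begin
    single x (var x ⊕ ε e) x [ t / x ]  ≡⟨ cong (_[ t / x ]) (single-≡ x _) ⟩
    single x t x ⊕ ε (e [ t / x ])      ≡⟨ cong₂ (λ a b → a ⊕ ε b) (single-≡ x t) (subst-fresh e t x∉e) ⟩
    t ⊕ ε e                             ≡⟨ sym (single-≡ x _) ⟩
    single x (t ⊕ ε e) x                ∎
  ... | no n≢x = begin
    single x (var x ⊕ ε e) n [ t / x ]  ≡⟨ cong (_[ t / x ]) (single-≢ _ n≢x) ⟩
    single x t n                        ≡⟨ single-≢ t n≢x ⟩
    var n                               ≡⟨ sym (single-≢ _ n≢x) ⟩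
    single x (t ⊕ ε e) n                ∎

∼ε-isEquivalence : IsEquivalence _∼ε_
∼ε-isEquivalence = record { refl = ∼refl ; sym = ∼sym ; trans = ∼trans }

⊕-isCommutativeSemigroup : IsCommutativeSemigroup _∼ε_ _⊕_
⊕-isCommutativeSemigroup = record
  { isSemigroup = record
    { isMagma = record { isEquivalence = ∼ε-isEquivalence ; ∙-cong = c-⊕ }
    ; assoc   = λ _ _ _ → ax-assoc
    }
  ; comm = λ _ _ → ax-comm
  }

⊕-commutativeSemigroup : CommutativeSemigroup 0ℓ 0ℓ
⊕-commutativeSemigroup = record { isCommutativeSemigroup = ⊕-isCommutativeSemigroup }

open CommutativeSemigroup ⊕-commutativeSemigroup using (setoid; reflexive)
open import Algebra.Properties.CommutativeSemigroup ⊕-commutativeSemigroup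
  using (interchange; x∙yz≈xz∙y)
open import Relation.Binary.Reasoning.Setoid setoid

Taylor : Tm → Tm → Tm → ℕ → Set
Taylor s t e x = s [ t ⊕ ε e / x ] ∼ε s [ t / x ] ⊕ ε ((∂ s x e) [ t / x ])

⊕-ε𝟘-introʳ : ∀ {s} → s ∼ε s ⊕ ε 𝟘
⊕-ε𝟘-introʳ = ∼sym (∼trans (c-⊕ ∼refl ax-ε0) ax-unit)

taylor-var : ∀ y t e x → ¬ (x ∈FV e) → Taylor (var y) t e x
taylor-var y t e x x∉e with y ≡ᵇ x
... | true  = c-⊕ ∼refl (c-ε (reflexive (sym (subst-fresh e t x∉e))))
... | false = ⊕-ε𝟘-introʳ

taylor-lam : ∀ s t e x →
  Taylor s (rename suc t) (rename suc e) (suc x) → Taylor (lam s) t e x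
taylor-lam s t e x ih = begin
  lam (subst (exts (single x (t ⊕ ε e))) s)
    ≡⟨ cong lam (subst-cong (exts-single x _) s) ⟩
  lam (s [ t′ ⊕ ε e′ / suc x ])
    ≈⟨ c-lam ih ⟩
  lam (s [ t′ / suc x ] ⊕ ε (∂ s (suc x) e′ [ t′ / suc x ]))
    ≡⟨ sym (cong₂ (λ a b → lam (a ⊕ ε b)) (subst-cong (exts-single x t) s)
                                          (subst-cong (exts-single x t) (∂ s (suc x) e′))) ⟩
  lam (subst (exts (single x t)) s ⊕ ε (subst (exts (single x t)) (∂ s (suc x) e′)))
    ≈⟨ ∼trans ax-λ+ (c-⊕ ∼refl ax-λε) ⟩
  lam (subst (exts (single x t)) s) ⊕ ε (lam (subst (exts (single x t)) (∂ s (suc x) e′)))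
    ∎
  where
  t′ = rename suc t
  e′ = rename suc e

taylor-app : ∀ s u t e x → ¬ (x ∈FV e) →
  Taylor s t e x → Taylor u t e x → Taylor (app s u) t e x
taylor-app s u t e x x∉e ih-s ih-u = begin
  app (s [ t ⊕ ε e / x ]) u₁
    ≈⟨ c-app ih-s ∼refl ⟩
  app (s₀ ⊕ ε ∂s₀) u₁
    ≈⟨ ∼trans ax-app+ (c-⊕ ∼refl ax-appε) ⟩
  app s₀ u₁ ⊕ ε (app ∂s₀ u₁)
    ≈⟨ c-⊕ (c-app ∼refl ih-u) ∼refl ⟩
  app s₀ (u₀ ⊕ ε ∂u₀) ⊕ ε (app ∂s₀ u₁)
    ≈⟨ c-⊕ ax-taylor ∼refl ⟩
  app s₀ u₀ ⊕ ε (app (D s₀ · ∂u₀) u₀) ⊕ ε (app ∂s₀ u₁)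
    ≈⟨ ∼trans ax-assoc (c-⊕ ∼refl (∼sym ax-ε+)) ⟩
  app s₀ u₀ ⊕ ε (app (D s₀ · ∂u₀) u₀ ⊕ app ∂s₀ u₁)
    ≡⟨ cong (λ v → app s₀ u₀ ⊕ ε (app (D s₀ · ∂u₀) u₀ ⊕ app ∂s₀ v))
            (sym (subst-perturbed-fusion t e x∉e u)) ⟩
  app s₀ u₀ ⊕ ε (∂ (app s u) x e [ t / x ])
    ∎
  where
  s₀ = s [ t / x ]
  u₀ = u [ t / x ]
  u₁ = u [ t ⊕ ε e / x ]
  ∂s₀ = ∂ s x e [ t / x ]
  ∂u₀ = ∂ u x e [ t / x ]

taylor-D : ∀ s u t e x → ¬ (x ∈FV e) →
  Taylor s t e x → Taylor u t e x → Taylor (D s · u) t e x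
taylor-D s u t e x x∉e ih-s ih-u = begin
  D s [ t ⊕ ε e / x ] · u₁
    ≈⟨ c-D ih-s ∼refl ⟩
  D (s₀ ⊕ ε ∂s₀) · u₁
    ≈⟨ ∼trans ax-D+ˡ (c-⊕ ∼refl ax-Dεˡ) ⟩
  D s₀ · u₁ ⊕ ε (D ∂s₀ · u₁)
    ≈⟨ c-⊕ (c-D ∼refl ih-u) ∼refl ⟩
  D s₀ · (u₀ ⊕ ε ∂u₀) ⊕ ε (D ∂s₀ · u₁)
    ≈⟨ c-⊕ (∼trans ax-D+ʳ (c-⊕ (c-⊕ ∼refl ax-Dεʳ) (c-ε ax-Dεʳ))) ∼refl ⟩
  D s₀ · u₀ ⊕ ε (D s₀ · ∂u₀) ⊕ ε (ε (D (D s₀ · u₀) · ∂u₀)) ⊕ ε (D ∂s₀ · u₁)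
    ≈⟨ ∼trans ax-assoc ax-assoc ⟩
  D s₀ · u₀ ⊕ (ε (D s₀ · ∂u₀) ⊕ (ε (ε (D (D s₀ · u₀) · ∂u₀)) ⊕ ε (D ∂s₀ · u₁)))
    ≈⟨ c-⊕ ∼refl (x∙yz≈xz∙y _ _ _) ⟩
  D s₀ · u₀ ⊕ (ε (D s₀ · ∂u₀) ⊕ ε (D ∂s₀ · u₁) ⊕ ε (ε (D (D s₀ · u₀) · ∂u₀)))
    ≈⟨ c-⊕ ∼refl (∼sym (∼trans ax-ε+ (c-⊕ ax-ε+ ∼refl))) ⟩
  D s₀ · u₀ ⊕ ε (D s₀ · ∂u₀ ⊕ D ∂s₀ · u₁ ⊕ ε (D (D s₀ · u₀) · ∂u₀))
    ≡⟨ cong (λ v → D s₀ · u₀ ⊕ ε (D s₀ · ∂u₀ ⊕ D ∂s₀ · v ⊕ ε (D (D s₀ · u₀) · ∂u₀)))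
            (sym (subst-perturbed-fusion t e x∉e u)) ⟩
  D s₀ · u₀ ⊕ ε (∂ (D s · u) x e [ t / x ])
    ∎
  where
  s₀ = s [ t / x ]
  u₀ = u [ t / x ]
  u₁ = u [ t ⊕ ε e / x ]
  ∂s₀ = ∂ s x e [ t / x ]
  ∂u₀ = ∂ u x e [ t / x ]

taylor-ε : ∀ s t e x → Taylor s t e x → Taylor (ε s) t e x
taylor-ε s t e x ih = ∼trans (c-ε ih) ax-ε+

taylor-⊕ : ∀ s u t e x → Taylor s t e x → Taylor u t e x → Taylor (s ⊕ u) t e x
taylor-⊕ s u t e x ih-s ih-u =
  ∼trans (c-⊕ ih-s ih-u) (∼trans (interchange _ _ _ _) (c-⊕ ∼refl (∼sym ax-ε+)))

mainTheorem3 : (s t e : Tm) (x : ℕ) → ¬ (x ∈FV e) →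
    s [ t ⊕ ε e / x ] ∼ε s [ t / x ] ⊕ ε ((∂ s x e) [ t / x ])
mainTheorem3 (var y)   t e x x∉e = taylor-var y t e x x∉e
mainTheorem3 (lam s)   t e x x∉e =
  taylor-lam s t e x (mainTheorem3 s _ _ (suc x) (∉FV-rename suc-injective e x∉e))
mainTheorem3 (app s u) t e x x∉e =
  taylor-app s u t e x x∉e (mainTheorem3 s t e x x∉e) (mainTheorem3 u t e x x∉e)
mainTheorem3 (D s · u) t e x x∉e =
  taylor-D s u t e x x∉e (mainTheorem3 s t e x x∉e) (mainTheorem3 u t e x x∉e)
mainTheorem3 (ε s)     t e x x∉e = taylor-ε s t e x (mainTheorem3 s t e x x∉e)
mainTheorem3 (s ⊕ u)   t e x x∉e =
  taylor-⊕ s u t e x (mainTheorem3 s t e x x∉e) (mainTheorem3 u t e x x∉e)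
mainTheorem3 𝟘         t e x x∉e = ⊕-ε𝟘-introʳ
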